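{- For non-negative integers $r,s$ and non-negative integers $m\geq n$, $$\sum_{k=0}^n\frac{(m-2k)\binom{m+r+s}{m,r,s}\binom{m}{k}\binom{m+2r}{k+r}\binom{m+2s}{k+s}}{\binom{m+2r}{m+r}\binom{m+2s}{m+s}\binom{m+s}{n+s}}=(m-n)\sum_{j=0}^{m-n+r-1}\binom{n+j}{n}\binom{n+j+s}{m-n+s-1}.$$
   Context: Here $\binom{m+r+s}{m,r,s}=\frac{(m+r+s)!}{m!\,r!\,s!}$ is the multinomial coefficient. Convention: an empty sum equals $0$, and $\binom{N}{k}=0$ whenever $k<0$ or $k>N$. -}

module Defs where

open import Data.Nat as ℕ using (ℕ; zero; suc; _!)
open import Data.Nat.Combinatorics using (_C_)
open import Data.Integer as ℤ using (ℤ; +_)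
open import Data.Rational as ℚ using (ℚ; 0ℚ; _/_)
open import Data.List using (List; map; foldr; upTo)

-- Division of a rational by a natural number; dividing by 0 gives 0
-- (only ever applied to positive divisors in the statement).
_÷ℕ_ : ℚ → ℕ → ℚ
p ÷ℕ zero    = 0ℚ
p ÷ℕ (suc d) = p ℚ.* (+ 1 / suc d)

ℕtoℚ : ℕ → ℚ
ℕtoℚ n = + n / 1

ℤtoℚ : ℤ → ℚ
ℤtoℚ z = z / 1

multinomial : ℕ → ℕ → ℕ → ℚ
multinomial m r s = ℕtoℚ ((m ℕ.+ r ℕ.+ s) !) ÷ℕ ((m !) ℕ.* (r !) ℕ.* (s !))

-- binomial coefficient with integer lower index; 0 if k < 0 or k > N
binomℤ : ℕ → ℤ → ℕ
binomℤ N (+ k)      = N C k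
binomℤ N ℤ.-[1+ _ ] = 0

Σ< : ℕ → (ℕ → ℚ) → ℚ
Σ< n f = foldr ℚ._+_ 0ℚ (map f (upTo n))

lhsTerm : ℕ → ℕ → ℕ → ℕ → ℕ → ℚ
lhsTerm m n r s k =
  (ℤtoℚ ((+ m) ℤ.- (+ (2 ℕ.* k)))
     ℚ.* multinomial m r s
     ℚ.* ℕtoℚ (m C k)
     ℚ.* ℕtoℚ ((m ℕ.+ 2 ℕ.* r) C (k ℕ.+ r))
     ℚ.* ℕtoℚ ((m ℕ.+ 2 ℕ.* s) C (k ℕ.+ s)))
  ÷ℕ (((m ℕ.+ 2 ℕ.* r) C (m ℕ.+ r)) ℕ.* ((m ℕ.+ 2 ℕ.* s) C (m ℕ.+ s))
        ℕ.* ((m ℕ.+ s) C (n ℕ.+ s)))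

LHS : ℕ → ℕ → ℕ → ℕ → ℚ
LHS m n r s = Σ< (suc n) (lhsTerm m n r s)

RHS : ℕ → ℕ → ℕ → ℕ → ℚ
RHS m n r s =
  ℤtoℚ ((+ m) ℤ.- (+ n)) ℚ.*
  Σ< (m ℕ.∸ n ℕ.+ r) (λ j →
    ℕtoℚ (((n ℕ.+ j) C n) ℕ.*
          binomℤ (n ℕ.+ j ℕ.+ s) ((+ m) ℤ.- (+ n) ℤ.+ (+ s) ℤ.- (+ 1))))

module Submission where

open import Defs
open import Data.Nat using (ℕ; _≤_)
open import Relation.Binary.PropositionalEquality using (_≡_)

-- Writing every binomial coefficient as a quotient of factorials, the k-th summand on the left is
-- T k / C(m+s,n+s) with the integer T k = (m-2k) C(m+r,k) C(m+s,k+s) C(m+r+s,k+r), so everything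
-- reduces to an identity in ℤ, proved by creative telescoping in n. Put
--   G n N = (m-n) C(m+s,n+s) C(N,n) C(N+s, m-n+s-1).
-- Then G (n+1) N - G n N is the forward difference in N of (m-2(n+1)) C(m+s,n+1+s) C(N,n+1) C(N+s,m-n-1+s),
-- whose sum over N < m+r is exactly T (n+1); together with the base case n = 0 this gives
-- T 0 + ... + T n = Σ_{N<m+r} G n N. Finally C(N,n) = 0 for N < n, and N = n + j turns the right-hand
-- sum into C(m+s,n+s) times the right side of the theorem.
-- Taking C(N,j) = 0 for negative j (Defs.binomℤ) makes the recurrence hold for all m, n, s and N.

module Binomials where
  open import Data.Nat
  open import Data.Nat.Properties
  open import Data.Nat.Combinatorics
  open import Data.Nat.DivMod using (m/n*n≡m)
  open import Data.Nat.Tactic.RingSolver using (solve-∀)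
  open import Data.Product using (_,_)
  open import Relation.Nullary using (yes; no)
  open import Relation.Binary.PropositionalEquality
  open ≡-Reasoning

  pascal : ∀ n k → suc n C suc k ≡ n C k + n C suc k
  pascal n k = sym (nCk+nC[k+1]≡[n+1]C[k+1] n k)

  absorption : ∀ n k → suc k * (n C suc k) + k * (n C k) ≡ n * (n C k)
  absorption zero    zero    = refl
  absorption zero    (suc k) = cong₂ _+_ (*-zeroʳ (2 + k)) (*-zeroʳ (suc k))
  absorption (suc n) zero    = begin
    1 * (suc n C 1) + 0  ≡⟨ cong (λ c → 1 * c + 0) (nC1≡n (suc n)) ⟩
    1 * suc n + 0        ≡⟨ +-identityʳ (1 * suc n) ⟩
    1 * suc n            ≡⟨ *-comm 1 (suc n) ⟩
    suc n * 1            ∎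
  absorption (suc n) (suc k) = begin
    (2 + k) * (suc n C (2 + k)) + suc k * (suc n C suc k)
      ≡⟨ cong₂ (λ x y → (2 + k) * x + suc k * y) (pascal n (suc k)) (pascal n k) ⟩
    (2 + k) * (b + c) + suc k * (a + b)
      ≡⟨ split k a b c ⟩
    ((2 + k) * c + suc k * b) + (suc k * b + k * a) + (a + b)
      ≡⟨ cong₂ (λ x y → x + y + (a + b)) (absorption n (suc k)) (absorption n k) ⟩
    n * b + n * a + (a + b)
      ≡⟨ merge n a b ⟩
    suc n * (a + b)
      ≡⟨ cong (suc n *_) (pascal n k) ⟨
    suc n * (suc n C suc k) ∎
    where
    a = n C k
    b = n C suc k
    c = n C (2 + k)
    split : ∀ k a b c →
      (2 + k) * (b + c) + suc k * (a + b) ≡ ((2 + k) * c + suc k * b) + (suc k * b + k * a) + (a + b)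
    split = solve-∀
    merge : ∀ n a b → n * b + n * a + (a + b) ≡ suc n * (a + b)
    merge = solve-∀

  C-factorial : ∀ x y → ((x + y) C x) * (x ! * y !) ≡ (x + y) !
  C-factorial x y = begin
    ((x + y) C x) * (x ! * y !)              ≡⟨ cong (λ d → ((x + y) C x) * (x ! * d !)) (m+n∸m≡n x y) ⟨
    ((x + y) C x) * (x ! * (x + y ∸ x) !)    ≡⟨ cong (_* (x ! * (x + y ∸ x) !)) (nCk≡n!/k![n-k]! x≤x+y) ⟩
    (x + y) ! / (x ! * (x + y ∸ x) !) * (x ! * (x + y ∸ x) !)  ≡⟨ m/n*n≡m (k![n∸k]!∣n! x≤x+y) ⟩
    (x + y) !                                ∎
    where
    x≤x+y = m≤m+n x y
    instance _ = x !* (x + y ∸ x) !≢0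

  C-factorial′ : ∀ {n} x y → x + y ≡ n → (n C x) * (x ! * y !) ≡ n !
  C-factorial′ x y refl = C-factorial x y

  C-nonZero : ∀ {n k} → k ≤ n → NonZero (n C k)
  C-nonZero {k = k} k≤n with m≤n⇒∃[o]m+o≡n k≤n
  ... | o , refl = m*n≢0⇒m≢0 ((k + o) C k) {{subst NonZero (sym (C-factorial k o)) ((k + o) !≢0)}}

  infixl 3 _*-nonZero_
  _*-nonZero_ : ∀ {m n} → NonZero m → NonZero n → NonZero (m * n)
  _*-nonZero_ {m} {n} m≢0 n≢0 = m*n≢0 m n {{m≢0}} {{n≢0}}

  lhsNumerator : ℕ → ℕ → ℕ → ℕ → ℕ
  lhsNumerator m r s k = (m + r + s) ! * (m C k) * ((m + 2 * r) C (k + r)) * ((m + 2 * s) C (k + s))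

  threeBinomials : ℕ → ℕ → ℕ → ℕ → ℕ
  threeBinomials m r s k = ((m + r) C k) * ((m + s) C (k + s)) * ((m + r + s) C (k + r))

  lhsDenominators : ℕ → ℕ → ℕ → ℕ → ℕ
  lhsDenominators k e r s = k ! * e ! * (k + r) ! * (e + r) ! * (k + s) ! * (e + s) !

  lhsNumerator-cleared : ∀ k e r s → let m = k + e in
    lhsNumerator m r s k * lhsDenominators k e r s ≡ (m + r + s) ! * m ! * (m + 2 * r) ! * (m + 2 * s) !
  lhsNumerator-cleared k e r s = begin
    (m + r + s) ! * c₁ * c₂ * c₃ * lhsDenominators k e r s
      ≡⟨ regroup ((m + r + s) !) c₁ c₂ c₃ (k !) (e !) ((k + r) !) ((e + r) !) ((k + s) !) ((e + s) !) ⟩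
    (m + r + s) ! * (c₁ * (k ! * e !)) * (c₂ * ((k + r) ! * (e + r) !)) * (c₃ * ((k + s) ! * (e + s) !))
      ≡⟨ cong₂ (λ x y → (m + r + s) ! * x * y * (c₃ * ((k + s) ! * (e + s) !)))
               (C-factorial k e) (C-factorial′ (k + r) (e + r) (twice k e r)) ⟩
    (m + r + s) ! * m ! * (m + 2 * r) ! * (c₃ * ((k + s) ! * (e + s) !))
      ≡⟨ cong ((m + r + s) ! * m ! * (m + 2 * r) ! *_) (C-factorial′ (k + s) (e + s) (twice k e s)) ⟩
    (m + r + s) ! * m ! * (m + 2 * r) ! * (m + 2 * s) ! ∎
    where
    m = k + e
    c₁ = m C k
    c₂ = (m + 2 * r) C (k + r)
    c₃ = (m + 2 * s) C (k + s)
    regroup : ∀ f c₁ c₂ c₃ x₁ y₁ x₂ y₂ x₃ y₃ →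
      f * c₁ * c₂ * c₃ * (x₁ * y₁ * x₂ * y₂ * x₃ * y₃)
        ≡ f * (c₁ * (x₁ * y₁)) * (c₂ * (x₂ * y₂)) * (c₃ * (x₃ * y₃))
    regroup = solve-∀
    twice : ∀ k e r → k + r + (e + r) ≡ k + e + 2 * r
    twice = solve-∀

  threeBinomials-cleared : ∀ k e r s → let m = k + e in
    threeBinomials m r s k * lhsDenominators k e r s ≡ (m + r) ! * (m + s) ! * (m + r + s) !
  threeBinomials-cleared k e r s = begin
    b₁ * b₂ * b₃ * lhsDenominators k e r s
      ≡⟨ regroup b₁ b₂ b₃ (k !) (e !) ((k + r) !) ((e + r) !) ((k + s) !) ((e + s) !) ⟩
    (b₁ * (k ! * (e + r) !)) * (b₂ * ((k + s) ! * e !)) * (b₃ * ((k + r) ! * (e + s) !))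
      ≡⟨ cong₂ (λ x y → x * y * (b₃ * ((k + r) ! * (e + s) !)))
               (C-factorial′ k (e + r) (sym (+-assoc k e r))) (C-factorial′ (k + s) e (+-right k e s)) ⟩
    (m + r) ! * (m + s) ! * (b₃ * ((k + r) ! * (e + s) !))
      ≡⟨ cong ((m + r) ! * (m + s) ! *_) (C-factorial′ (k + r) (e + s) (shuffle k e r s)) ⟩
    (m + r) ! * (m + s) ! * (m + r + s) ! ∎
    where
    m = k + e
    b₁ = (m + r) C k
    b₂ = (m + s) C (k + s)
    b₃ = (m + r + s) C (k + r)
    regroup : ∀ c₁ c₂ c₃ x₁ y₁ x₂ y₂ x₃ y₃ →
      c₁ * c₂ * c₃ * (x₁ * y₁ * x₂ * y₂ * x₃ * y₃)
        ≡ (c₁ * (x₁ * y₂)) * (c₂ * (x₃ * y₁)) * (c₃ * (x₂ * y₃))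
    regroup = solve-∀
    +-right : ∀ k e s → k + s + e ≡ k + e + s
    +-right = solve-∀
    shuffle : ∀ k e r s → k + r + (e + s) ≡ k + e + r + s
    shuffle = solve-∀

  lhsNumerator≡threeBinomials : ∀ m r s k →
    lhsNumerator m r s k ≡ threeBinomials m r s k * (m ! * r ! * s ! * (((m + 2 * r) C (m + r)) * ((m + 2 * s) C (m + s))))
  lhsNumerator≡threeBinomials m r s k with k ≤? m
  ... | yes k≤m with m≤n⇒∃[o]m+o≡n k≤m
  ...   | e , refl = *-cancelʳ-≡ _ _ (lhsDenominators k e r s) {{denominators≢0}} (begin
    lhsNumerator m r s k * lhsDenominators k e r s
      ≡⟨ lhsNumerator-cleared k e r s ⟩
    (m + r + s) ! * m ! * (m + 2 * r) ! * (m + 2 * s) !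
      ≡⟨ cong₂ (λ x y → (m + r + s) ! * m ! * x * y)
               (C-factorial′ (m + r) r (double m r)) (C-factorial′ (m + s) s (double m s)) ⟨
    (m + r + s) ! * m ! * (A * ((m + r) ! * r !)) * (B * ((m + s) ! * s !))
      ≡⟨ regroup ((m + r) !) ((m + s) !) ((m + r + s) !) (m !) (r !) (s !) A B ⟨
    (m + r) ! * (m + s) ! * (m + r + s) ! * (m ! * r ! * s ! * (A * B))
      ≡⟨ cong (_* (m ! * r ! * s ! * (A * B))) (threeBinomials-cleared k e r s) ⟨
    threeBinomials m r s k * lhsDenominators k e r s * (m ! * r ! * s ! * (A * B))
      ≡⟨ right-comm (threeBinomials m r s k) (lhsDenominators k e r s) (m ! * r ! * s ! * (A * B)) ⟩
    threeBinomials m r s k * (m ! * r ! * s ! * (A * B)) * lhsDenominators k e r s ∎)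
    where
    A = (k + e + 2 * r) C (k + e + r)
    B = (k + e + 2 * s) C (k + e + s)
    denominators≢0 = k !≢0 *-nonZero e !≢0 *-nonZero (k + r) !≢0 *-nonZero (e + r) !≢0
                       *-nonZero (k + s) !≢0 *-nonZero (e + s) !≢0
    regroup : ∀ a b c f x y u v → a * b * c * (f * x * y * (u * v)) ≡ c * f * (u * (a * x)) * (v * (b * y))
    regroup = solve-∀
    right-comm : ∀ a b c → a * b * c ≡ a * c * b
    right-comm = solve-∀
    double : ∀ m r → m + r + r ≡ m + 2 * r
    double = solve-∀
  lhsNumerator≡threeBinomials m r s k | no k≰m
    rewrite k>n⇒nCk≡0 (≰⇒> k≰m) | k>n⇒nCk≡0 (+-monoˡ-< s (≰⇒> k≰m))
          | *-zeroʳ ((m + r + s) !) | *-zeroʳ ((m + r) C k) = refl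

module BinomialsWithIntegerIndex where
  open Binomials using (pascal; absorption)
  open import Data.Nat as ℕ using (zero; suc)
  import Data.Nat.Properties as ℕ
  open import Data.Nat.Combinatorics using (_C_; k>n⇒nCk≡0; nCk≡nC[n∸k])
  open import Data.Integer using (+_; -[1+_]; _+_; _-_; _*_; -_)
  open import Data.Integer.Properties using (pos-*; *-zeroʳ)
  open import Data.Integer.Tactic.RingSolver using (solve-∀)
  open import Data.Product using (_,_)
  open import Relation.Nullary using (yes; no)
  open import Relation.Binary.PropositionalEquality
  open ≡-Reasoning

  absorptionℤ : ∀ n k → + suc k * + (n C suc k) ≡ (+ n - + k) * + (n C k)
  absorptionℤ n k = begin
    + suc k * + (n C suc k)                ≡⟨ pos-* (suc k) (n C suc k) ⟨
    + (suc k ℕ.* (n C suc k))              ≡⟨ add-sub _ (+ (k ℕ.* (n C k))) ⟩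
    + (suc k ℕ.* (n C suc k) ℕ.+ k ℕ.* (n C k)) - + (k ℕ.* (n C k))
      ≡⟨ cong (λ t → + t - + (k ℕ.* (n C k))) (absorption n k) ⟩
    + (n ℕ.* (n C k)) - + (k ℕ.* (n C k))  ≡⟨ cong₂ _-_ (pos-* n (n C k)) (pos-* k (n C k)) ⟩
    + n * + (n C k) - + k * + (n C k)      ≡⟨ sub-distrib (+ n) (+ k) (+ (n C k)) ⟩
    (+ n - + k) * + (n C k)                ∎
    where
    add-sub : ∀ p q → p ≡ p + q - q
    add-sub = solve-∀
    sub-distrib : ∀ a b c → a * c - b * c ≡ (a - b) * c
    sub-distrib = solve-∀

  binomℤ-pascal : ∀ n j → binomℤ (suc n) j ≡ binomℤ n (j - + 1) ℕ.+ binomℤ n j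
  binomℤ-pascal n (+ zero)  = refl
  binomℤ-pascal n (+ suc k) = pascal n k
  binomℤ-pascal n -[1+ _ ]  = refl

  binomℤ-absorption : ∀ n j → j * + binomℤ n j ≡ (+ n - j + + 1) * + binomℤ n (j - + 1)
  binomℤ-absorption n (+ zero)  = sym (*-zeroʳ (+ n - + 0 + + 1))
  binomℤ-absorption n (+ suc k) = trans (absorptionℤ n k) (cong (_* + (n C k)) (shift (+ n) (+ k)))
    where
    shift : ∀ a b → a - b ≡ a - (+ 1 + b) + + 1
    shift = solve-∀
  binomℤ-absorption n -[1+ i ]  = trans (*-zeroʳ -[1+ i ]) (sym (*-zeroʳ (+ n - -[1+ i ] + + 1)))

  binomℤ-complement : ∀ n k → binomℤ n (+ n - + k) ≡ n C k
  binomℤ-complement n k with k ℕ.≤? n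
  ... | yes k≤n with ℕ.m≤n⇒∃[o]m+o≡n k≤n
  ...   | o , refl = begin
    binomℤ (k ℕ.+ o) (+ k + + o - + k)  ≡⟨ cong (binomℤ (k ℕ.+ o)) (cancel (+ k) (+ o)) ⟩
    (k ℕ.+ o) C o                       ≡⟨ cong ((k ℕ.+ o) C_) (ℕ.m+n∸m≡n k o) ⟨
    (k ℕ.+ o) C (k ℕ.+ o ℕ.∸ k)         ≡⟨ nCk≡nC[n∸k] (ℕ.m≤m+n k o) ⟨
    (k ℕ.+ o) C k                       ∎
    where
    cancel : ∀ a b → a + b - a ≡ b
    cancel = solve-∀
  binomℤ-complement n k | no k≰n with ℕ.m≤n⇒∃[o]m+o≡n (ℕ.≰⇒> k≰n)
  ...   | o , refl = begin
    binomℤ n (+ n - + (suc n ℕ.+ o))  ≡⟨ cong (binomℤ n) (overshoot (+ n) (+ o)) ⟩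
    0                                 ≡⟨ k>n⇒nCk≡0 (ℕ.≰⇒> k≰n) ⟨
    n C (suc n ℕ.+ o)                 ∎
    where
    overshoot : ∀ a b → a - (+ 1 + a + b) ≡ - (+ 1 + b)
    overshoot = solve-∀

module IntegerSums where
  open import Data.Nat as ℕ using (ℕ; zero; suc; _<_)
  import Data.Nat.Properties as ℕ
  open import Data.Integer using (ℤ; 0ℤ; _+_; _-_; _*_)
  open import Data.Integer.Properties using (+-identityʳ; +-comm; +-assoc; *-zeroʳ; *-distribˡ-+; +-inverseʳ)
  open import Data.Integer.Tactic.RingSolver using (solve-∀)
  open import Function using (_∘_)
  open import Relation.Binary.PropositionalEquality
  open ≡-Reasoning

  ∑ : ℕ → (ℕ → ℤ) → ℤ
  ∑ zero    f = 0ℤ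
  ∑ (suc n) f = ∑ n f + f n

  syntax ∑ n (λ k → e) = ∑[ k < n ] e

  ∑-cong : ∀ n {f g : ℕ → ℤ} → (∀ k → f k ≡ g k) → ∑ n f ≡ ∑ n g
  ∑-cong zero    f≗g = refl
  ∑-cong (suc n) f≗g = cong₂ _+_ (∑-cong n f≗g) (f≗g n)

  ∑-zero : ∀ n {f : ℕ → ℤ} → (∀ k → k < n → f k ≡ 0ℤ) → ∑ n f ≡ 0ℤ
  ∑-zero zero    f≡0 = refl
  ∑-zero (suc n) f≡0 = cong₂ _+_ (∑-zero n (λ k k<n → f≡0 k (ℕ.m<n⇒m<1+n k<n))) (f≡0 n ℕ.≤-refl)

  ∑-+ : ∀ n (f g : ℕ → ℤ) → ∑[ k < n ] (f k + g k) ≡ ∑ n f + ∑ n g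
  ∑-+ zero    f g = refl
  ∑-+ (suc n) f g = trans (cong (_+ (f n + g n)) (∑-+ n f g)) (interchange (∑ n f) (∑ n g) (f n) (g n))
    where
    interchange : ∀ a b c d → a + b + (c + d) ≡ a + c + (b + d)
    interchange = solve-∀

  ∑-*ˡ : ∀ n c (f : ℕ → ℤ) → ∑[ k < n ] (c * f k) ≡ c * ∑ n f
  ∑-*ˡ zero    c f = sym (*-zeroʳ c)
  ∑-*ˡ (suc n) c f = trans (cong (_+ c * f n) (∑-*ˡ n c f)) (sym (*-distribˡ-+ c (∑ n f) (f n)))

  ∑-telescope : ∀ n (v : ℕ → ℤ) → ∑[ k < n ] (v (suc k) - v k) ≡ v n - v 0
  ∑-telescope zero    v = sym (+-inverseʳ (v 0))
  ∑-telescope (suc n) v = trans (cong (_+ (v (suc n) - v n)) (∑-telescope n v)) (chain (v (suc n)) (v n) (v 0))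
    where
    chain : ∀ a b c → b - c + (a - b) ≡ a - c
    chain = solve-∀

  ∑-split : ∀ a b (f : ℕ → ℤ) → ∑ (a ℕ.+ b) f ≡ ∑ a f + ∑[ j < b ] f (a ℕ.+ j)
  ∑-split a zero    f = trans (cong (λ n → ∑ n f) (ℕ.+-identityʳ a)) (sym (+-identityʳ (∑ a f)))
  ∑-split a (suc b) f = begin
    ∑ (a ℕ.+ suc b) f                             ≡⟨ cong (λ n → ∑ n f) (ℕ.+-suc a b) ⟩
    ∑ (a ℕ.+ b) f + f (a ℕ.+ b)                   ≡⟨ cong (_+ f (a ℕ.+ b)) (∑-split a b f) ⟩
    ∑ a f + ∑[ j < b ] f (a ℕ.+ j) + f (a ℕ.+ b)  ≡⟨ +-assoc (∑ a f) _ _ ⟩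
    ∑ a f + ∑[ j < suc b ] f (a ℕ.+ j)            ∎

  ∑-cons : ∀ n (f : ℕ → ℤ) → ∑ (suc n) f ≡ f 0 + ∑ n (f ∘ suc)
  ∑-cons zero    f = +-comm 0ℤ (f 0)
  ∑-cons (suc n) f = trans (cong (_+ f (suc n)) (∑-cons n f)) (+-assoc (f 0) _ _)

module IntegerIdentity where
  open Binomials using (pascal; threeBinomials)
  open BinomialsWithIntegerIndex
  open IntegerSums
  open import Data.Nat as ℕ using (ℕ; zero; suc; _≤_)
  import Data.Nat.Properties as ℕ
  open import Data.Nat.Combinatorics using (_C_; k>n⇒nCk≡0)
  open import Data.Integer using (ℤ; +_; 0ℤ; _+_; _-_; _*_)
  open import Data.Integer.Properties using (pos-*; *-zeroʳ; +-identityˡ)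
  open import Data.Integer.Tactic.RingSolver using (solve-∀; solve)
  open import Data.List using (_∷_; [])
  open import Relation.Binary.PropositionalEquality
  open ≡-Reasoning

  pos-*³ : ∀ a b c → + (a ℕ.* b ℕ.* c) ≡ + a * + b * + c
  pos-*³ a b c = trans (pos-* (a ℕ.* b) c) (cong (_* + c) (pos-* a b))

  lhsSummand : ℕ → ℕ → ℕ → ℕ → ℤ
  lhsSummand m r s k = (+ m - + (2 ℕ.* k)) * + threeBinomials m r s k

  rhsSummand : ℕ → ℕ → ℕ → ℕ → ℤ
  rhsSummand m n s N = + ((N C n) ℕ.* binomℤ (N ℕ.+ s) (+ m - + n + + s - + 1))

  kernel : ℕ → ℕ → ℕ → ℕ → ℤ
  kernel m n s N = (+ m - + n) * + ((m ℕ.+ s) C (n ℕ.+ s)) * rhsSummand m n s N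

  antidifference : ℕ → ℕ → ℕ → ℕ → ℤ
  antidifference m n s N = + ((N C suc n) ℕ.* binomℤ (N ℕ.+ s) (+ m - + suc n + + s))

  -- X, Y, c₀, c₁, d₀, d₁ stand for C(m+s,n+1+s), C(m+s,n+s), C(N,n), C(N,n+1), C(N+s,j-1), C(N+s,j),
  -- and the hypotheses are the absorption identities between them.
  creative-telescoping : ∀ (m n s N X Y c₀ c₁ d₀ d₁ : ℤ) → let j = m - (+ 1 + n) + s in
    (+ 1 + (n + s)) * X ≡ (m + s - (n + s)) * Y →
    (+ 1 + n) * c₁ ≡ (N - n) * c₀ →
    j * d₁ ≡ (N + s - j + + 1) * d₀ →
    (m - (+ 1 + n)) * X * (c₁ * d₀)
      ≡ (m - n) * Y * (c₀ * d₁) + (m - + 2 * (+ 1 + n)) * X * ((c₀ + c₁) * (d₀ + d₁) - c₁ * d₁)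
  creative-telescoping m n s N X Y c₀ c₁ d₀ d₁ hX hc hd = sym (begin
    (m - n) * Y * (c₀ * d₁) + (m - + 2 * (+ 1 + n)) * X * ((c₀ + c₁) * (d₀ + d₁) - c₁ * d₁)
      ≡⟨ solve (m ∷ n ∷ s ∷ Y ∷ X ∷ c₀ ∷ c₁ ∷ d₀ ∷ d₁ ∷ []) ⟩
    c₀ * d₁ * ((m + s - (n + s)) * Y) + (m - + 2 * (+ 1 + n)) * X * ((c₀ + c₁) * (d₀ + d₁) - c₁ * d₁)
      ≡⟨ cong (λ t → c₀ * d₁ * t + (m - + 2 * (+ 1 + n)) * X * ((c₀ + c₁) * (d₀ + d₁) - c₁ * d₁)) hX ⟨
    c₀ * d₁ * ((+ 1 + (n + s)) * X) + (m - + 2 * (+ 1 + n)) * X * ((c₀ + c₁) * (d₀ + d₁) - c₁ * d₁)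
      ≡⟨ solve (m ∷ n ∷ s ∷ X ∷ c₀ ∷ c₁ ∷ d₀ ∷ d₁ ∷ []) ⟩
    (m - (+ 1 + n)) * X * (c₁ * d₀)
      + X * (c₀ * ((m - (+ 1 + n) + s) * d₁) + (m - + 2 * (+ 1 + n)) * c₀ * d₀ - d₀ * ((+ 1 + n) * c₁))
      ≡⟨ cong₂ (λ u v → (m - (+ 1 + n)) * X * (c₁ * d₀) + X * (c₀ * u + (m - + 2 * (+ 1 + n)) * c₀ * d₀ - d₀ * v))
               hd hc ⟩
    (m - (+ 1 + n)) * X * (c₁ * d₀)
      + X * (c₀ * ((N + s - (m - (+ 1 + n) + s) + + 1) * d₀) + (m - + 2 * (+ 1 + n)) * c₀ * d₀ - d₀ * ((N - n) * c₀))
      ≡⟨ solve (m ∷ n ∷ s ∷ N ∷ X ∷ c₀ ∷ c₁ ∷ d₀ ∷ []) ⟩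
    (m - (+ 1 + n)) * X * (c₁ * d₀) ∎)

  kernel-recurrence : ∀ m n s N →
    kernel m (suc n) s N
      ≡ kernel m n s N + (+ m - + (2 ℕ.* suc n)) * + ((m ℕ.+ s) C (suc n ℕ.+ s))
                         * (antidifference m n s (suc N) - antidifference m n s N)
  kernel-recurrence m n s N = begin
    kernel m (suc n) s N
      ≡⟨ cong ((+ m - + suc n) * + X *_) (pos-* c₁ d₀) ⟩
    (+ m - + suc n) * + X * (+ c₁ * + d₀)
      ≡⟨ creative-telescoping (+ m) (+ n) (+ s) (+ N) (+ X) (+ Y) (+ c₀) (+ c₁) (+ d₀) (+ d₁)
           (absorptionℤ (m ℕ.+ s) (n ℕ.+ s)) (absorptionℤ N n) (binomℤ-absorption (N ℕ.+ s) j) ⟩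
    (+ m - + n) * + Y * (+ c₀ * + d₁) + κ * + X * ((+ c₀ + + c₁) * (+ d₀ + + d₁) - + c₁ * + d₁)
      ≡⟨ cong₂ (λ u v → (+ m - + n) * + Y * u + κ * + X * v) kernel-factor (sym Δantidifference) ⟩
    kernel m n s N + κ * + X * (antidifference m n s (suc N) - antidifference m n s N) ∎
    where
    X = (m ℕ.+ s) C (suc n ℕ.+ s)
    Y = (m ℕ.+ s) C (n ℕ.+ s)
    c₀ = N C n
    c₁ = N C suc n
    j = + m - + suc n + + s
    d₀ = binomℤ (N ℕ.+ s) (j - + 1)
    d₁ = binomℤ (N ℕ.+ s) j
    κ = + m - + (2 ℕ.* suc n)
    index : ∀ m n s → m - n + s - + 1 ≡ m - (+ 1 + n) + s
    index = solve-∀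
    kernel-factor : + c₀ * + d₁ ≡ rhsSummand m n s N
    kernel-factor = begin
      + c₀ * + d₁         ≡⟨ pos-* c₀ d₁ ⟨
      + (c₀ ℕ.* d₁)       ≡⟨ cong (λ i → + (c₀ ℕ.* binomℤ (N ℕ.+ s) i)) (index (+ m) (+ n) (+ s)) ⟨
      rhsSummand m n s N  ∎
    Δantidifference : antidifference m n s (suc N) - antidifference m n s N
                        ≡ (+ c₀ + + c₁) * (+ d₀ + + d₁) - + c₁ * + d₁
    Δantidifference = cong₂ _-_
      (trans (cong₂ (λ u v → + (u ℕ.* v)) (pascal N n) (binomℤ-pascal (N ℕ.+ s) j))
             (pos-* (c₀ ℕ.+ c₁) (d₀ ℕ.+ d₁)))
      (pos-* c₁ d₁)

  ∑kernel-base : ∀ m r s → ∑[ N < m ℕ.+ r ] kernel m 0 s N ≡ lhsSummand m r s 0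
  ∑kernel-base m r s = begin
    ∑[ N < m ℕ.+ r ] kernel m 0 s N          ≡⟨ ∑-cong (m ℕ.+ r) kernel≡κΔw ⟩
    ∑[ N < m ℕ.+ r ] (κ * (w (suc N) - w N))  ≡⟨ ∑-*ˡ (m ℕ.+ r) κ (λ N → w (suc N) - w N) ⟩
    κ * ∑[ N < m ℕ.+ r ] (w (suc N) - w N)    ≡⟨ cong (κ *_) (∑-telescope (m ℕ.+ r) w) ⟩
    κ * (w (m ℕ.+ r) - w 0)                  ≡⟨ cong (λ t → κ * (+ t - w 0)) upper-boundary ⟩
    κ * (+ Z - w 0)                          ≡⟨ expand (+ m - + 0) (+ Y) (+ Z) (w 0) ⟩
    (+ m - + 0) * + Y * + Z - + Y * ((+ m - + 0) * w 0)
      ≡⟨ cong (λ t → (+ m - + 0) * + Y * + Z - + Y * t) (lower-boundary m) ⟩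
    (+ m - + 0) * + Y * + Z - + Y * 0ℤ       ≡⟨ drop (+ m - + 0) (+ Y) (+ Z) ⟩
    (+ m - + 0) * (+ 1 * + Y * + Z)          ≡⟨ cong ((+ m - + 0) *_) (pos-*³ 1 Y Z) ⟨
    lhsSummand m r s 0                       ∎
    where
    Y = (m ℕ.+ s) C s
    Z = (m ℕ.+ r ℕ.+ s) C r
    i = + m - + 0 + + s
    κ = (+ m - + 0) * + Y
    w : ℕ → ℤ
    w N = + binomℤ (N ℕ.+ s) i
    kernel≡κΔw : ∀ N → kernel m 0 s N ≡ κ * (w (suc N) - w N)
    kernel≡κΔw N = cong (κ *_) (begin
      + ((N C 0) ℕ.* binomℤ (N ℕ.+ s) (i - + 1))  ≡⟨ cong +_ (ℕ.*-identityˡ _) ⟩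
      + binomℤ (N ℕ.+ s) (i - + 1)                ≡⟨ add-sub _ (w N) ⟩
      + binomℤ (N ℕ.+ s) (i - + 1) + w N - w N     ≡⟨ cong (λ t → + t - w N) (binomℤ-pascal (N ℕ.+ s) i) ⟨
      w (suc N) - w N                             ∎)
      where
      add-sub : ∀ p q → p ≡ p + q - q
      add-sub = solve-∀
    upper-boundary : binomℤ (m ℕ.+ r ℕ.+ s) i ≡ Z
    upper-boundary = trans (cong (binomℤ (m ℕ.+ r ℕ.+ s)) (shift (+ m) (+ r) (+ s))) (binomℤ-complement (m ℕ.+ r ℕ.+ s) r)
      where
      shift : ∀ m r s → m - + 0 + s ≡ m + r + s - r
      shift = solve-∀
    lower-boundary : ∀ m → (+ m - + 0) * + binomℤ s (+ m - + 0 + + s) ≡ 0ℤ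
    lower-boundary zero    = refl
    lower-boundary (suc m) =
      trans (cong (λ t → (+ suc m - + 0) * + t) (k>n⇒nCk≡0 (ℕ.s≤s (ℕ.m≤n+m s (m ℕ.+ 0))))) (*-zeroʳ (+ suc m - + 0))
    expand : ∀ a y z v → a * y * (z - v) ≡ a * y * z - y * (a * v)
    expand = solve-∀
    drop : ∀ a y z → a * y * z - y * 0ℤ ≡ a * (+ 1 * y * z)
    drop = solve-∀

  antidifference-boundary : ∀ m r s n →
    (+ m - + (2 ℕ.* suc n)) * + ((m ℕ.+ s) C (suc n ℕ.+ s)) * (antidifference m n s (m ℕ.+ r) - antidifference m n s 0)
      ≡ lhsSummand m r s (suc n)
  antidifference-boundary m r s n = begin
    κ * + X * (+ (a ℕ.* binomℤ (m ℕ.+ r ℕ.+ s) (+ m - + suc n + + s)) - + 0)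
      ≡⟨ cong (λ t → κ * + X * (+ (a ℕ.* t) - + 0)) upper-boundary ⟩
    κ * + X * (+ (a ℕ.* b) - + 0)  ≡⟨ cong (λ t → κ * + X * (t - + 0)) (pos-* a b) ⟩
    κ * + X * (+ a * + b - + 0)    ≡⟨ regroup κ (+ X) (+ a) (+ b) ⟩
    κ * (+ a * + X * + b)          ≡⟨ cong (κ *_) (pos-*³ a X b) ⟨
    lhsSummand m r s (suc n)       ∎
    where
    κ = + m - + (2 ℕ.* suc n)
    X = (m ℕ.+ s) C (suc n ℕ.+ s)
    a = (m ℕ.+ r) C suc n
    b = (m ℕ.+ r ℕ.+ s) C (suc n ℕ.+ r)
    upper-boundary : binomℤ (m ℕ.+ r ℕ.+ s) (+ m - + suc n + + s) ≡ b
    upper-boundary =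
      trans (cong (binomℤ (m ℕ.+ r ℕ.+ s)) (shift (+ m) (+ n) (+ r) (+ s))) (binomℤ-complement (m ℕ.+ r ℕ.+ s) (suc n ℕ.+ r))
      where
      shift : ∀ m n r s → m - (+ 1 + n) + s ≡ m + r + s - (+ 1 + n + r)
      shift = solve-∀
    regroup : ∀ κ x a b → κ * x * (a * b - + 0) ≡ κ * (a * x * b)
    regroup = solve-∀

  ∑lhsSummand≡∑kernel : ∀ m r s n → ∑[ k < suc n ] lhsSummand m r s k ≡ ∑[ N < m ℕ.+ r ] kernel m n s N
  ∑lhsSummand≡∑kernel m r s zero    = trans (+-identityˡ (lhsSummand m r s 0)) (sym (∑kernel-base m r s))
  ∑lhsSummand≡∑kernel m r s (suc n) = begin
    ∑[ k < suc n ] lhsSummand m r s k + lhsSummand m r s (suc n)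
      ≡⟨ cong₂ _+_ (∑lhsSummand≡∑kernel m r s n) (sym (antidifference-boundary m r s n)) ⟩
    ∑ M (kernel m n s) + κ * (v M - v 0)
      ≡⟨ cong (λ t → ∑ M (kernel m n s) + κ * t) (∑-telescope M v) ⟨
    ∑ M (kernel m n s) + κ * ∑[ N < M ] (v (suc N) - v N)
      ≡⟨ cong (λ t → ∑ M (kernel m n s) + t) (∑-*ˡ M κ (λ N → v (suc N) - v N)) ⟨
    ∑ M (kernel m n s) + ∑[ N < M ] (κ * (v (suc N) - v N))
      ≡⟨ ∑-+ M (kernel m n s) (λ N → κ * (v (suc N) - v N)) ⟨
    ∑[ N < M ] (kernel m n s N + κ * (v (suc N) - v N))
      ≡⟨ ∑-cong M (λ N → kernel-recurrence m n s N) ⟨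
    ∑ M (kernel m (suc n) s) ∎
    where
    M = m ℕ.+ r
    κ = (+ m - + (2 ℕ.* suc n)) * + ((m ℕ.+ s) C (suc n ℕ.+ s))
    v = antidifference m n s

  ∑kernel≡rhs : ∀ m r s n → n ≤ m →
    ∑[ N < m ℕ.+ r ] kernel m n s N
      ≡ + ((m ℕ.+ s) C (n ℕ.+ s)) * ((+ m - + n) * ∑[ j < m ℕ.∸ n ℕ.+ r ] rhsSummand m n s (n ℕ.+ j))
  ∑kernel≡rhs m r s n n≤m = begin
    ∑ (m ℕ.+ r) (kernel m n s)                   ≡⟨ cong (λ M → ∑ M (kernel m n s)) range ⟩
    ∑ (n ℕ.+ L) (kernel m n s)                   ≡⟨ ∑-split n L (kernel m n s) ⟩
    ∑ n (kernel m n s) + ∑[ j < L ] kernel m n s (n ℕ.+ j)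
      ≡⟨ cong (_+ ∑[ j < L ] kernel m n s (n ℕ.+ j)) (∑-zero n below-n) ⟩
    0ℤ + ∑[ j < L ] (c * rhsSummand m n s (n ℕ.+ j))            ≡⟨ +-identityˡ _ ⟩
    ∑[ j < L ] (c * rhsSummand m n s (n ℕ.+ j))                 ≡⟨ ∑-*ˡ L c (λ j → rhsSummand m n s (n ℕ.+ j)) ⟩
    (+ m - + n) * + Y * ∑[ j < L ] rhsSummand m n s (n ℕ.+ j)   ≡⟨ swap (+ m - + n) (+ Y) _ ⟩
    + Y * ((+ m - + n) * ∑[ j < L ] rhsSummand m n s (n ℕ.+ j)) ∎
    where
    Y = (m ℕ.+ s) C (n ℕ.+ s)
    L = m ℕ.∸ n ℕ.+ r
    c = (+ m - + n) * + Y
    range : m ℕ.+ r ≡ n ℕ.+ L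
    range = trans (cong (ℕ._+ r) (sym (ℕ.m+[n∸m]≡n n≤m))) (ℕ.+-assoc n (m ℕ.∸ n) r)
    below-n : ∀ N → N ℕ.< n → kernel m n s N ≡ 0ℤ
    below-n N N<n =
      trans (cong (λ t → c * + (t ℕ.* binomℤ (N ℕ.+ s) (+ m - + n + + s - + 1))) (k>n⇒nCk≡0 N<n)) (*-zeroʳ c)
    swap : ∀ a y t → a * y * t ≡ y * (a * t)
    swap = solve-∀

module RationalFractions where
  open IntegerSums using (∑; ∑-cons)
  open import Data.Nat as ℕ using (ℕ; zero; suc; NonZero)
  import Data.Nat.Properties as ℕ
  open import Data.Integer as ℤ using (+_)
  import Data.Integer.Properties as ℤ
  open import Data.Rational using (_/_; 0ℚ; _+_; _*_)
  import Data.Rational.Properties as ℚ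
  open import Data.Rational.Unnormalised using (mkℚᵘ; *≡*)
  import Data.Rational.Unnormalised.Properties as ℚᵘ
  open import Data.List using ([]; _∷_; map; foldr; upTo; applyUpTo)
  open import Data.List.Properties using (map-applyUpTo; map-cong)
  open import Function using (_∘_; id)
  open import Relation.Binary.PropositionalEquality
  open ≡-Reasoning

  /-congʳ : ∀ i {a b} .{{_ : NonZero a}} .{{_ : NonZero b}} → a ≡ b → i / a ≡ i / b
  /-congʳ i refl = refl

  /-*-/ : ∀ i j a b .{{_ : NonZero a}} .{{_ : NonZero b}} →
          (i / a) * (j / b) ≡ ((i ℤ.* j) / (a ℕ.* b)) {{ℕ.m*n≢0 a b}}
  /-*-/ i j (suc a) (suc b) = ℚ.toℚᵘ-injective
    (ℚᵘ.≃-trans (ℚ.toℚᵘ-homo-* (i / suc a) (j / suc b))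
    (ℚᵘ.≃-trans (ℚᵘ.*-cong (ℚ.toℚᵘ-fromℚᵘ (mkℚᵘ i a)) (ℚ.toℚᵘ-fromℚᵘ (mkℚᵘ j b)))
                (ℚᵘ.≃-sym (ℚ.toℚᵘ-fromℚᵘ (mkℚᵘ (i ℤ.* j) (b ℕ.+ a ℕ.* suc b))))))

  /-≡ : ∀ i j a b .{{_ : NonZero a}} .{{_ : NonZero b}} → i ℤ.* + b ≡ j ℤ.* + a → i / a ≡ j / b
  /-≡ i j (suc a) (suc b) eq = ℚ.fromℚᵘ-cong {mkℚᵘ i a} {mkℚᵘ j b} (*≡* eq)

  /-÷ℕ : ∀ i a d .{{_ : NonZero a}} .{{_ : NonZero d}} → (i / a) ÷ℕ d ≡ (i / (a ℕ.* d)) {{ℕ.m*n≢0 a d}}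
  /-÷ℕ i a (suc d) =
    trans (/-*-/ i (+ 1) a (suc d)) (cong (λ j → (j / (a ℕ.* suc d)) {{ℕ.m*n≢0 a (suc d)}}) (ℤ.*-identityʳ i))

  ℤtoℚ-*-/ : ∀ i j b .{{_ : NonZero b}} → ℤtoℚ i * (j / b) ≡ i ℤ.* j / b
  ℤtoℚ-*-/ i j b = trans (/-*-/ i j 1 b) (/-congʳ (i ℤ.* j) {{ℕ.m*n≢0 1 b}} (ℕ.*-identityˡ b))

  /-*-ℤtoℚ : ∀ i j a .{{_ : NonZero a}} → (i / a) * ℤtoℚ j ≡ i ℤ.* j / a
  /-*-ℤtoℚ i j a = trans (/-*-/ i j a 1) (/-congʳ (i ℤ.* j) {{ℕ.m*n≢0 a 1}} (ℕ.*-identityʳ a))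

  ℤtoℚ-÷ℕ : ∀ i d .{{_ : NonZero d}} → ℤtoℚ i ÷ℕ d ≡ i / d
  ℤtoℚ-÷ℕ i d = trans (/-÷ℕ i 1 d) (/-congʳ i {{ℕ.m*n≢0 1 d}} (ℕ.*-identityˡ d))

  ℤtoℚ-*-÷ℕ-cancelˡ : ∀ i c .{{_ : NonZero c}} → ℤtoℚ (+ c ℤ.* i) ÷ℕ c ≡ ℤtoℚ i
  ℤtoℚ-*-÷ℕ-cancelˡ i c =
    trans (ℤtoℚ-÷ℕ (+ c ℤ.* i) c) (/-≡ (+ c ℤ.* i) i c 1 (trans (ℤ.*-identityʳ _) (ℤ.*-comm (+ c) i)))

  ℤtoℚ-* : ∀ i j → ℤtoℚ (i ℤ.* j) ≡ ℤtoℚ i * ℤtoℚ j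
  ℤtoℚ-* i j = sym (/-*-/ i j 1 1)

  ℤtoℚ-+ : ∀ i j → ℤtoℚ (i ℤ.+ j) ≡ ℤtoℚ i + ℤtoℚ j
  ℤtoℚ-+ i j = ℚ.toℚᵘ-injective
    (ℚᵘ.≃-trans (ℚ.toℚᵘ-fromℚᵘ (mkℚᵘ (i ℤ.+ j) 0))
    (ℚᵘ.≃-trans (*≡* (cong (ℤ._* + 1) (sym (cong₂ ℤ._+_ (ℤ.*-identityʳ i) (ℤ.*-identityʳ j)))))
    (ℚᵘ.≃-trans (ℚᵘ.≃-sym (ℚᵘ.+-cong (ℚ.toℚᵘ-fromℚᵘ (mkℚᵘ i 0)) (ℚ.toℚᵘ-fromℚᵘ (mkℚᵘ j 0))))
                (ℚᵘ.≃-sym (ℚ.toℚᵘ-homo-+ (ℤtoℚ i) (ℤtoℚ j))))))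

  ÷ℕ-distribʳ-+ : ∀ p q d → (p + q) ÷ℕ d ≡ p ÷ℕ d + q ÷ℕ d
  ÷ℕ-distribʳ-+ p q zero    = sym (ℚ.+-identityʳ 0ℚ)
  ÷ℕ-distribʳ-+ p q (suc d) = ℚ.*-distribʳ-+ (+ 1 / suc d) p q

  0÷ℕ : ∀ d → 0ℚ ÷ℕ d ≡ 0ℚ
  0÷ℕ zero    = refl
  0÷ℕ (suc d) = ℚ.*-zeroˡ (+ 1 / suc d)

  Σ<-cong : ∀ n {f g} → (∀ k → f k ≡ g k) → Σ< n f ≡ Σ< n g
  Σ<-cong n f≗g = cong (foldr _+_ 0ℚ) (map-cong f≗g (upTo n))

  Σ<-÷ℕ : ∀ n f d → Σ< n (λ k → f k ÷ℕ d) ≡ Σ< n f ÷ℕ d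
  Σ<-÷ℕ n f d = go (upTo n)
    where
    go : ∀ ks → foldr _+_ 0ℚ (map (λ k → f k ÷ℕ d) ks) ≡ foldr _+_ 0ℚ (map f ks) ÷ℕ d
    go []       = sym (0÷ℕ d)
    go (k ∷ ks) = trans (cong (_+_ (f k ÷ℕ d)) (go ks)) (sym (÷ℕ-distribʳ-+ (f k) _ d))

  Σ<-ℤtoℚ : ∀ n f → Σ< n (λ k → ℤtoℚ (f k)) ≡ ℤtoℚ (∑ n f)
  Σ<-ℤtoℚ n f = trans (cong (foldr _+_ 0ℚ) (map-applyUpTo id (ℤtoℚ ∘ f) n)) (go n f)
    where
    go : ∀ n f → foldr _+_ 0ℚ (applyUpTo (ℤtoℚ ∘ f) n) ≡ ℤtoℚ (∑ n f)
    go zero    f = refl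
    go (suc n) f = begin
      ℤtoℚ (f 0) + foldr _+_ 0ℚ (applyUpTo (ℤtoℚ ∘ f ∘ suc) n)  ≡⟨ cong (_+_ (ℤtoℚ (f 0))) (go n (f ∘ suc)) ⟩
      ℤtoℚ (f 0) + ℤtoℚ (∑ n (f ∘ suc))                         ≡⟨ ℤtoℚ-+ (f 0) _ ⟨
      ℤtoℚ (f 0 ℤ.+ ∑ n (f ∘ suc))                              ≡⟨ cong ℤtoℚ (∑-cons n f) ⟨
      ℤtoℚ (∑ (suc n) f)                                        ∎

module LeftHandSide where
  open Binomials using (_*-nonZero_; C-nonZero; threeBinomials; lhsNumerator≡threeBinomials)
  open IntegerIdentity using (lhsSummand)
  open RationalFractions
  open import Data.Nat as ℕ using (NonZero; _!)
  import Data.Nat.Properties as ℕ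
  open import Data.Nat.Combinatorics using (_C_)
  open import Data.Nat.Tactic.RingSolver using (solve-∀)
  open import Data.Integer as ℤ using (+_)
  import Data.Integer.Properties as ℤ
  open import Data.Rational using (_/_; _*_)
  open import Relation.Binary.PropositionalEquality
  open ≡-Reasoning

  *-pos-* : ∀ z x y → z ℤ.* + x ℤ.* + y ≡ z ℤ.* + (x ℕ.* y)
  *-pos-* z x y = trans (ℤ.*-assoc z (+ x) (+ y)) (cong (z ℤ.*_) (sym (ℤ.pos-* x y)))

  lhsTerm≡lhsSummand÷ℕ : ∀ m n r s k {{Cn≢0 : NonZero ((m ℕ.+ s) C (n ℕ.+ s))}} →
    lhsTerm m n r s k ≡ ℤtoℚ (lhsSummand m r s k) ÷ℕ ((m ℕ.+ s) C (n ℕ.+ s))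
  lhsTerm≡lhsSummand÷ℕ m n r s k {{Cn≢0}} = begin
    (ℤtoℚ z * (ℕtoℚ f ÷ℕ q) * ℕtoℚ c₁ * ℕtoℚ c₂ * ℕtoℚ c₃) ÷ℕ D
      ≡⟨ cong (λ p → (p * ℕtoℚ c₁ * ℕtoℚ c₂ * ℕtoℚ c₃) ÷ℕ D)
              (trans (cong (ℤtoℚ z *_) (ℤtoℚ-÷ℕ (+ f) q)) (ℤtoℚ-*-/ z (+ f) q)) ⟩
    ((z ℤ.* + f) / q * ℕtoℚ c₁ * ℕtoℚ c₂ * ℕtoℚ c₃) ÷ℕ D
      ≡⟨ cong (λ p → (p * ℕtoℚ c₂ * ℕtoℚ c₃) ÷ℕ D) (absorb f c₁) ⟩
    ((z ℤ.* + (f ℕ.* c₁)) / q * ℕtoℚ c₂ * ℕtoℚ c₃) ÷ℕ D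
      ≡⟨ cong (λ p → (p * ℕtoℚ c₃) ÷ℕ D) (absorb (f ℕ.* c₁) c₂) ⟩
    ((z ℤ.* + (f ℕ.* c₁ ℕ.* c₂)) / q * ℕtoℚ c₃) ÷ℕ D
      ≡⟨ cong (_÷ℕ D) (absorb (f ℕ.* c₁ ℕ.* c₂) c₃) ⟩
    ((z ℤ.* + X) / q) ÷ℕ D
      ≡⟨ /-÷ℕ (z ℤ.* + X) q D ⟩
    ((z ℤ.* + X) / (q ℕ.* D)) {{q*D≢0}}
      ≡⟨ /-≡ (z ℤ.* + X) (lhsSummand m r s k) (q ℕ.* D) Cn {{q*D≢0}} cross-multiplied ⟩
    lhsSummand m r s k / Cn
      ≡⟨ ℤtoℚ-÷ℕ (lhsSummand m r s k) Cn ⟨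
    ℤtoℚ (lhsSummand m r s k) ÷ℕ Cn ∎
    where
    z = + m ℤ.- + (2 ℕ.* k)
    f = (m ℕ.+ r ℕ.+ s) !
    q = m ! ℕ.* r ! ℕ.* s !
    c₁ = m C k
    c₂ = (m ℕ.+ 2 ℕ.* r) C (k ℕ.+ r)
    c₃ = (m ℕ.+ 2 ℕ.* s) C (k ℕ.+ s)
    X = f ℕ.* c₁ ℕ.* c₂ ℕ.* c₃
    A = (m ℕ.+ 2 ℕ.* r) C (m ℕ.+ r)
    B = (m ℕ.+ 2 ℕ.* s) C (m ℕ.+ s)
    Cn = (m ℕ.+ s) C (n ℕ.+ s)
    D = A ℕ.* B ℕ.* Cn
    instance
      q≢0 : NonZero q
      q≢0 = m ℕ.!≢0 *-nonZero r ℕ.!≢0 *-nonZero s ℕ.!≢0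
      D≢0 : NonZero D
      D≢0 = C-nonZero (ℕ.+-monoʳ-≤ m (ℕ.m≤m+n r (r ℕ.+ 0)))
              *-nonZero C-nonZero (ℕ.+-monoʳ-≤ m (ℕ.m≤m+n s (s ℕ.+ 0)))
              *-nonZero Cn≢0
    q*D≢0 : NonZero (q ℕ.* D)
    q*D≢0 = q≢0 *-nonZero D≢0
    absorb : ∀ x c → (z ℤ.* + x) / q * ℕtoℚ c ≡ z ℤ.* + (x ℕ.* c) / q
    absorb x c = trans (/-*-ℤtoℚ (z ℤ.* + x) (+ c) q) (cong (_/ q) (*-pos-* z x c))
    cross-multiplied : z ℤ.* + X ℤ.* + Cn ≡ lhsSummand m r s k ℤ.* + (q ℕ.* D)
    cross-multiplied = begin
      z ℤ.* + X ℤ.* + Cn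
        ≡⟨ *-pos-* z X Cn ⟩
      z ℤ.* + (X ℕ.* Cn)
        ≡⟨ cong (λ t → z ℤ.* + (t ℕ.* Cn)) (lhsNumerator≡threeBinomials m r s k) ⟩
      z ℤ.* + (threeBinomials m r s k ℕ.* (q ℕ.* (A ℕ.* B)) ℕ.* Cn)
        ≡⟨ cong (λ t → z ℤ.* + t) (regroup (threeBinomials m r s k) q A B Cn) ⟩
      z ℤ.* + (threeBinomials m r s k ℕ.* (q ℕ.* D))
        ≡⟨ *-pos-* z (threeBinomials m r s k) (q ℕ.* D) ⟨
      lhsSummand m r s k ℤ.* + (q ℕ.* D) ∎
      where
      regroup : ∀ F q A B C → F ℕ.* (q ℕ.* (A ℕ.* B)) ℕ.* C ≡ F ℕ.* (q ℕ.* (A ℕ.* B ℕ.* C))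
      regroup = solve-∀

open Binomials using (C-nonZero)
open IntegerSums using (∑)
open IntegerIdentity using (lhsSummand; rhsSummand; kernel; ∑lhsSummand≡∑kernel; ∑kernel≡rhs)
open RationalFractions using (Σ<-cong; Σ<-÷ℕ; Σ<-ℤtoℚ; ℤtoℚ-*-÷ℕ-cancelˡ; ℤtoℚ-*)
open LeftHandSide using (lhsTerm≡lhsSummand÷ℕ)
open import Data.Nat using (suc; _+_; _∸_)
open import Data.Nat.Properties using (+-monoˡ-≤)
open import Data.Nat.Combinatorics using (_C_)
open import Data.Integer as ℤ using (+_)
open import Data.Rational using (_*_)
open import Function using (_∘_)
open import Relation.Binary.PropositionalEquality using (cong; module ≡-Reasoning)
open ≡-Reasoning

theorem2p2 : (r s m n : ℕ) → n ≤ m → LHS m n r s ≡ RHS m n r s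
theorem2p2 r s m n n≤m = begin
  Σ< (suc n) (lhsTerm m n r s)
    ≡⟨ Σ<-cong (suc n) (λ k → lhsTerm≡lhsSummand÷ℕ m n r s k) ⟩
  Σ< (suc n) (λ k → ℤtoℚ (lhsSummand m r s k) ÷ℕ Cn)
    ≡⟨ Σ<-÷ℕ (suc n) (ℤtoℚ ∘ lhsSummand m r s) Cn ⟩
  Σ< (suc n) (ℤtoℚ ∘ lhsSummand m r s) ÷ℕ Cn
    ≡⟨ cong (_÷ℕ Cn) (Σ<-ℤtoℚ (suc n) (lhsSummand m r s)) ⟩
  ℤtoℚ (∑[ k < suc n ] lhsSummand m r s k) ÷ℕ Cn
    ≡⟨ cong (λ t → ℤtoℚ t ÷ℕ Cn) (∑lhsSummand≡∑kernel m r s n) ⟩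
  ℤtoℚ (∑[ N < m + r ] kernel m n s N) ÷ℕ Cn
    ≡⟨ cong (λ t → ℤtoℚ t ÷ℕ Cn) (∑kernel≡rhs m r s n n≤m) ⟩
  ℤtoℚ (+ Cn ℤ.* (m-n ℤ.* ∑ L rhs)) ÷ℕ Cn
    ≡⟨ ℤtoℚ-*-÷ℕ-cancelˡ (m-n ℤ.* ∑ L rhs) Cn ⟩
  ℤtoℚ (m-n ℤ.* ∑ L rhs)
    ≡⟨ ℤtoℚ-* m-n (∑ L rhs) ⟩
  ℤtoℚ m-n * ℤtoℚ (∑ L rhs)
    ≡⟨ cong (ℤtoℚ m-n *_) (Σ<-ℤtoℚ L rhs) ⟨
  RHS m n r s ∎
  where
  Cn = (m + s) C (n + s)
  m-n = + m ℤ.- + n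
  L = m ∸ n + r
  rhs = λ j → rhsSummand m n s (n + j)
  instance
    Cn≢0 = C-nonZero (+-monoˡ-≤ s n≤m)
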